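{- Let $U$ be a finite set, $\mathcal{F}\subseteq 2^U$ a set family and $k$ a natural number. If $\mathcal{F}$ is a closure difference, then the set family $k\mathcal{F}\subseteq 2^{[k]\times U}$ is also a closure difference.
   Context: For a universe $W$, $\uparrow(\mathcal{G})=\{S\subseteq W:\exists T\in\mathcal{G},T\subseteq S\}$; $\mathcal{G}\subseteq 2^W$ is a closure difference if $\mathcal{G}=\uparrow(\mathcal{G}_+)\setminus\uparrow(\mathcal{G}_-)$ for some families $\mathcal{G}_+,\mathcal{G}_-\subseteq 2^W$. For $i\in[k]$ and $S\subseteq[k]\times U$ let $\pi^i_U(S)=\{u\in U:(i,u)\in S\}$. Then $k\mathcal{F}=\{S\subseteq[k]\times U:\pi^i_U(S)\in\mathcal{F}\text{ for all }i\in[k]\}$. -}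

module Defs where

open import Data.Bool using (Bool; true)
open import Data.Fin using (Fin)
open import Data.Nat using (ℕ)
open import Data.Product using (Σ; _×_; _,_)
open import Level using (Level; _⊔_; suc; zero)
open import Relation.Nullary using (¬_)
open import Relation.Binary.PropositionalEquality using (_≡_)
open import Function.Bundles using (_⇔_)

SubsetOf : Set → Set
SubsetOf W = W → Bool

Family : Set → Set₁
Family W = SubsetOf W → Set

_⊆_ : {W : Set} → SubsetOf W → SubsetOf W → Set
_⊆_ {W} T S = (w : W) → T w ≡ true → S w ≡ true

↑ : {W : Set} → Family W → Family W
↑ {W} G S = Σ (SubsetOf W) (λ T → G T × (T ⊆ S))

IsClosureDifference : {W : Set} → Family W → Set₁
IsClosureDifference {W} G =
  Σ (Family W) (λ G₊ → Σ (Family W) (λ G₋ →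
    (S : SubsetOf W) → G S ⇔ (↑ G₊ S × ¬ ↑ G₋ S)))

π : {K U : Set} → K → SubsetOf (K × U) → SubsetOf U
π i S u = S (i , u)

_·_ : {U : Set} → (k : ℕ) → Family U → Family (Fin k × U)
(k · F) S = (i : Fin k) → F (π i S)

{-# OPTIONS --safe #-}
module Submission where

open import Defs
open import Data.Nat using (ℕ)
open import Data.Fin using (Fin)
open import Data.Product using (∃; _×_; _,_; proj₁; proj₂)
open import Function.Bundles using (_⇔_; mk⇔; Equivalence)
open Equivalence using (to; from)
open import Relation.Nullary using (¬_)

-- Writing k𝓕 as the family of sets all of whose slices lie in 𝓕 = ↑𝓖₊ ∖ ↑𝓖₋, one may take
-- (k𝓕)₊ = {S | every slice of S lies in ↑𝓖₊} and (k𝓕)₋ = {S | some slice of S lies in ↑𝓖₋}.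
-- Both families are upward closed, since slicing is monotone, so they are their own upward
-- closures; and "every slice in ↑𝓖₊ and none in ↑𝓖₋" is exactly "every slice in 𝓕".

⊆-trans : {W : Set} {R S T : SubsetOf W} → R ⊆ S → S ⊆ T → R ⊆ T
⊆-trans R⊆S S⊆T w p = S⊆T w (R⊆S w p)

π-mono : {K U : Set} (i : K) {S T : SubsetOf (K × U)} → S ⊆ T → π i S ⊆ π i T
π-mono i S⊆T u = S⊆T (i , u)

UpwardClosed : {W : Set} → Family W → Set
UpwardClosed {W} G = {S T : SubsetOf W} → S ⊆ T → G S → G T

↑-extensive : {W : Set} {G : Family W} {S : SubsetOf W} → G S → ↑ G S
↑-extensive {S = S} g = S , g , λ w p → p

↑-upwardClosed : {W : Set} {G : Family W} → UpwardClosed (↑ G)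
↑-upwardClosed S⊆T (R , g , R⊆S) = R , g , ⊆-trans R⊆S S⊆T

↑-of-upwardClosed : {W : Set} {G : Family W} {S : SubsetOf W} →
  UpwardClosed G → ↑ G S → G S
↑-of-upwardClosed G↑ (R , g , R⊆S) = G↑ R⊆S g

everySlice : {K U : Set} → Family U → Family (K × U)
everySlice {K} G S = (i : K) → G (π i S)

someSlice : {K U : Set} → Family U → Family (K × U)
someSlice {K} G S = ∃ λ (i : K) → G (π i S)

everySlice-upwardClosed : {K U : Set} {G : Family U} →
  UpwardClosed G → UpwardClosed (everySlice {K} G)
everySlice-upwardClosed G↑ S⊆T g i = G↑ (π-mono i S⊆T) (g i)

someSlice-upwardClosed : {K U : Set} {G : Family U} →
  UpwardClosed G → UpwardClosed (someSlice {K} G)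
someSlice-upwardClosed G↑ S⊆T (i , g) = i , G↑ (π-mono i S⊆T) g

everySlice-closureDifference : {K U : Set} {F : Family U} →
  IsClosureDifference F → IsClosureDifference (everySlice {K} F)
everySlice-closureDifference {F = F} (G₊ , G₋ , F⇔) =
  everySlice (↑ G₊) , someSlice (↑ G₋) , λ S → mk⇔ (slices⇒ S) (⇒slices S)
  where
  slices⇒ : ∀ S → everySlice F S →
    ↑ (everySlice (↑ G₊)) S × ¬ ↑ (someSlice (↑ G₋)) S
  slices⇒ S FS = ↑-extensive (λ i → proj₁ (slice i)) , λ ↑G₋S →
    let (i , g₋) = ↑-of-upwardClosed (someSlice-upwardClosed ↑-upwardClosed) ↑G₋S
    in proj₂ (slice i) g₋
    where
    slice = λ i → to (F⇔ (π i S)) (FS i)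
  ⇒slices : ∀ S → ↑ (everySlice (↑ G₊)) S × ¬ ↑ (someSlice (↑ G₋)) S → everySlice F S
  ⇒slices S (↑G₊S , ¬↑G₋S) i = from (F⇔ (π i S))
    ( ↑-of-upwardClosed (everySlice-upwardClosed ↑-upwardClosed) ↑G₊S i
    , λ g₋ → ¬↑G₋S (↑-extensive (i , g₋)) )

lemma49 : (n : ℕ) (F : Family (Fin n)) (k : ℕ) →
    IsClosureDifference F → IsClosureDifference (k · F)
lemma49 n F k = everySlice-closureDifference
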